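{- Let $d\ge3$, $h\ge1$, $1\le n\le h$, and let $j$ be a vertex at depth $n$ of $\mathcal{T}(d,h)$. Then in the sandpile group $G(d,h)$, $$\theta(d,h+2-n)\,\bar{\mathbf{x}}_j-\theta(d,h+1-n)\,\bar{\mathbf{x}}_{p(j)}=0,$$ where $\theta(d,m)=\frac{(d-1)^m-1}{d-2}$.
   Context: Let $\mathcal{T}(d,h)$ be the ball of radius $h$ about a root vertex $0$ in the infinite $d$-regular tree (root has $d$ children, vertices at depth $1,\dots,h-1$ have $d-1$ children, depth-$h$ vertices are leaves; depth is the distance from $0$). Let $V$ be its vertex set, $p(i)$ the parent of $i\neq 0$, $C_i$ the children of $i$, $\{\mathbf{x}_i\}$ the standard basis of $\mathbb{Z}^V$, and $\delta_i = d\mathbf{x}_i - \mathbf{x}_{p(i)} - \sum_{j\in C_i}\mathbf{x}_j$ (omit $\mathbf{x}_{p(i)}$ for $i=0$; empty sum for leaves). The sandpile group is $G(d,h)=\mathbb{Z}^V/\sum_{i\in V}\mathbb{Z}\delta_i$, and $\bar{\mathbf{v}}$ denotes the image of $\mathbf{v}\in\mathbb{Z}^V$. -}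

module Defs where

open import Data.Nat using (ℕ; zero; suc; _∸_; _^_; _≤_; _/_)
open import Data.Fin using (Fin)
open import Data.Fin.Properties using () renaming (_≟_ to _≟F_)
open import Data.Bool using (Bool; true; false; _∧_; if_then_else_)
open import Data.Product using (Σ; _×_; _,_; proj₁; proj₂)
open import Data.Integer using (ℤ; +_; _-_; _+_; _*_)
open import Relation.Nullary.Decidable using (⌊_⌋)
open import Relation.Binary.PropositionalEquality using (_≡_)

-- Addresses of vertices at depth k in the d-regular tree:
-- the root, a child of the root (Fin d choices), or a child of a
-- non-root vertex (Fin (d ∸ 1) choices).
data Addr (d : ℕ) : ℕ → Set where
  root  : Addr d 0
  top   : Fin d → Addr d 1
  child : ∀ {k} → Addr d (suc k) → Fin (d ∸ 1) → Addr d (suc (suc k))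

V : ℕ → ℕ → Set
V d h = Σ ℕ (λ k → (k ≤ h) × Addr d k)

depth : ∀ {d h} → V d h → ℕ
depth = proj₁

parentA : ∀ {d k} → Addr d (suc k) → Addr d k
parentA (top _)     = root
parentA (child a _) = a

sameA : ∀ {d k m} → Addr d k → Addr d m → Bool
sameA root root = true
sameA (top a) (top b) = ⌊ a ≟F b ⌋
sameA (child u a) (child v b) = sameA u v ∧ ⌊ a ≟F b ⌋
sameA _ _ = false

addr : ∀ {d h} (x : V d h) → Addr d (depth x)
addr x = proj₂ (proj₂ x)

sameV : ∀ {d h} → V d h → V d h → Bool
sameV x y = sameA (addr x) (addr y)

ind : ∀ {d h} → V d h → V d h → ℤ
ind x y = if sameV x y then + 1 else + 0

isChildOf : ∀ {d k m} → Addr d k → Addr d m → Bool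
isChildOf root i = false
isChildOf (top a) i = sameA root i
isChildOf (child u a) i = sameA u i

Vec : ℕ → ℕ → Set
Vec d h = V d h → ℤ

𝐱 : ∀ {d h} → V d h → Vec d h
𝐱 j x = ind x j

-- parent p(j) as a vertex (junk value: p(0) = 0, never used)
p : ∀ {d h} → V d h → V d h
p (zero , le , root) = (zero , le , root)
p (suc k , le , a) = (k , Data.Nat.Properties.≤-trans (Data.Nat.Properties.n≤1+n k) le , parentA a)
  where import Data.Nat.Properties

-- δ_i = d x_i - x_{p(i)} - Σ_{j ∈ C_i} x_j  (no parent term for i = 0)
δ : (d h : ℕ) → V d h → Vec d h
δ d h i x =
  ((+ d) * ind x i
    - (if isChildOf (addr i) (addr x) then + 1 else + 0))
    - (if isChildOf (addr x) (addr i) then + 1 else + 0)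

-- The subgroup Σ_i ℤ δ_i of ℤ^V (generated subgroup, vectors compared pointwise)
data InSpan (d h : ℕ) : Vec d h → Set where
  zeroV : ∀ {v} → (∀ x → v x ≡ + 0) → InSpan d h v
  addδ  : ∀ {v w} i → InSpan d h v → (∀ x → w x ≡ v x + δ d h i x) → InSpan d h w
  subδ  : ∀ {v w} i → InSpan d h v → (∀ x → w x ≡ v x - δ d h i x) → InSpan d h w

-- v̄ = 0 in the sandpile group G(d,h) = ℤ^V / Σ ℤ δ_i
IsZeroInG : (d h : ℕ) → Vec d h → Set
IsZeroInG = InSpan

-- θ(d,m) = ((d-1)^m - 1)/(d-2), defined for d ≥ 3 (junk 0 for d < 3)
θ : ℕ → ℕ → ℕ
θ (suc (suc (suc e))) m = ((suc (suc e)) ^ m ∸ 1) / suc e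
θ _ m = 0

-- Write θₘ for θ(d,m), the base-(d−1) repunit: θ₀ = 0 and θₘ₊₁ = (d−1)θₘ + 1.
-- Induct on the distance r = h − depth j from j to the leaves. For a leaf,
-- θ₂ 𝐱ⱼ − θ₁ 𝐱ₚ₍ⱼ₎ = d 𝐱ⱼ − 𝐱ₚ₍ⱼ₎ = δⱼ. Otherwise, because θᵣ₊₂ − (d−1)θᵣ₊₁ = 1,
--   θᵣ₊₃ 𝐱ⱼ − θᵣ₊₂ 𝐱ₚ₍ⱼ₎ = θᵣ₊₂ δⱼ + Σ_{c ∈ Cⱼ} (θᵣ₊₂ 𝐱_c − θᵣ₊₁ 𝐱ⱼ),
-- and every summand vanishes in G(d,h) by induction. The argument works for all
-- d ≥ 1; d ≥ 3 is only needed to identify the repunit with ((d−1)^m − 1)/(d−2).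

module Submission where

open import Defs
open import Data.Nat using (ℕ; zero; suc; s≤s; z≤n; _≤_; _+_; _∸_; _^_)
import Data.Nat as ℕ
import Data.Nat.Properties as ℕ
open import Data.Nat.DivMod using (m*n/n≡m)
open import Data.Integer as ℤ using (ℤ; +_; _*_; _-_) renaming (_+_ to _+ℤ_)
import Data.Integer.Properties as ℤ
open import Data.Integer.Tactic.RingSolver using (solve-∀; solve)
open import Data.List using (_∷_; [])
open import Data.Nat.Tactic.RingSolver using () renaming (solve-∀ to solveℕ-∀)
open import Algebra.Properties.Semiring.Sum ℤ.+-*-semiring
  using (sum; sum-cong-≗; sum-replicate-zero; sum-remove; ∑-distrib-+; *-distribˡ-sum)
open import Data.Fin as Fin using (Fin; punchIn)
open import Data.Fin.Properties using (punchInᵢ≢i) renaming (_≟_ to _≟F_)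
open import Data.Bool using (Bool; true; false; _∧_; if_then_else_)
open import Data.Product using (_,_)
open import Data.Empty using (⊥-elim)
open import Function using (_∘_)
open import Relation.Nullary using (yes; no)
open import Relation.Nullary.Decidable using (⌊_⌋; isYes≗does; dec-true; dec-false)
open import Relation.Binary.PropositionalEquality
  using (_≡_; _≗_; refl; sym; trans; cong; cong₂; subst; module ≡-Reasoning)

module _ {d h : ℕ} where

  InSpan-resp : ∀ {v w : Vec d h} → InSpan d h v → w ≗ v → InSpan d h w
  InSpan-resp (zeroV v≗0)     w≗v = zeroV (λ x → trans (w≗v x) (v≗0 x))
  InSpan-resp (addδ i s v≗u+δ) w≗v = addδ i s (λ x → trans (w≗v x) (v≗u+δ x))
  InSpan-resp (subδ i s v≗u-δ) w≗v = subδ i s (λ x → trans (w≗v x) (v≗u-δ x))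

  InSpan-0 : InSpan d h (λ _ → + 0)
  InSpan-0 = zeroV (λ _ → refl)

  InSpan-δ : ∀ i → InSpan d h (δ d h i)
  InSpan-δ i = addδ i InSpan-0 (λ x → sym (ℤ.+-identityˡ _))

  InSpan-+ : ∀ {v w : Vec d h} → InSpan d h v → InSpan d h w → InSpan d h (λ x → v x +ℤ w x)
  InSpan-+ {v} s (zeroV w≗0) =
    InSpan-resp s (λ x → trans (cong (v x +ℤ_) (w≗0 x)) (ℤ.+-identityʳ (v x)))
  InSpan-+ {v} s (addδ {u} i t w≗u+δ) =
    addδ i (InSpan-+ s t) (λ x → trans (cong (v x +ℤ_) (w≗u+δ x)) (sym (ℤ.+-assoc (v x) (u x) _)))
  InSpan-+ {v} s (subδ {u} i t w≗u-δ) =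
    subδ i (InSpan-+ s t) (λ x → trans (cong (v x +ℤ_) (w≗u-δ x)) (sym (ℤ.+-assoc (v x) (u x) _)))

  InSpan-* : ∀ n {v : Vec d h} → InSpan d h v → InSpan d h (λ x → + n * v x)
  InSpan-* zero    s = zeroV (λ _ → refl)
  InSpan-* (suc n) {v} s = InSpan-resp (InSpan-+ s (InSpan-* n s)) (λ x → ℤ.suc-* (+ n) (v x))

  InSpan-sum : ∀ {n} (f : Fin n → Vec d h) → (∀ c → InSpan d h (f c)) →
               InSpan d h (λ x → sum (λ c → f c x))
  InSpan-sum {zero}  f s = InSpan-0
  InSpan-sum {suc n} f s = InSpan-+ (s Fin.zero) (InSpan-sum (f ∘ Fin.suc) (s ∘ Fin.suc))

𝟙 : Bool → ℤ
𝟙 b = if b then + 1 else + 0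

sum-affine : ∀ {n} (a b : ℤ) (f : Fin n → ℤ) → sum (λ c → a * f c - b) ≡ a * sum f - + n * b
sum-affine {n} a b f = begin
  sum (λ c → a * f c - b)                        ≡⟨ ∑-distrib-+ {n} (λ c → a * f c) (λ _ → ℤ.- b) ⟩
  sum (λ c → a * f c) +ℤ sum {n} (λ _ → ℤ.- b)   ≡⟨ cong₂ _+ℤ_ (sym (*-distribˡ-sum a f)) (sum-const n (ℤ.- b)) ⟩
  a * sum f +ℤ + n * ℤ.- b                       ≡⟨ cong (a * sum f +ℤ_) (sym (ℤ.neg-distribʳ-* (+ n) b)) ⟩
  a * sum f - + n * b                            ∎
  where
  open ≡-Reasoning
  sum-const : ∀ n y → sum {n} (λ _ → y) ≡ + n * y
  sum-const zero    y = refl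
  sum-const (suc n) y = trans (cong (y +ℤ_) (sum-const n y)) (sym (ℤ.suc-* (+ n) y))

⌊≟⌋-sym : ∀ {n} (a b : Fin n) → ⌊ a ≟F b ⌋ ≡ ⌊ b ≟F a ⌋
⌊≟⌋-sym a b with a ≟F b | b ≟F a
... | yes _   | yes _   = refl
... | no _    | no _    = refl
... | yes a≡b | no b≢a  = ⊥-elim (b≢a (sym a≡b))
... | no a≢b  | yes b≡a = ⊥-elim (a≢b (sym b≡a))

sum-𝟙-≟ : ∀ {n} (b : Fin n) → sum (λ c → 𝟙 ⌊ b ≟F c ⌋) ≡ + 1
sum-𝟙-≟ {suc n} b = begin
  sum (λ c → 𝟙 ⌊ b ≟F c ⌋)                            ≡⟨ sum-remove {i = b} (λ c → 𝟙 ⌊ b ≟F c ⌋) ⟩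
  𝟙 ⌊ b ≟F b ⌋ +ℤ sum (λ c → 𝟙 ⌊ b ≟F punchIn b c ⌋)  ≡⟨ cong₂ _+ℤ_ (cong 𝟙 b≟b) (trans (sum-cong-≗ b≟punchIn) (sum-replicate-zero n)) ⟩
  + 1 +ℤ + 0                                          ∎
  where
  open ≡-Reasoning
  b≟b : ⌊ b ≟F b ⌋ ≡ true
  b≟b = trans (isYes≗does (b ≟F b)) (dec-true (b ≟F b) refl)
  b≟punchIn : ∀ c → 𝟙 ⌊ b ≟F punchIn b c ⌋ ≡ + 0
  b≟punchIn c = cong 𝟙 (trans (isYes≗does (b ≟F punchIn b c))
                              (dec-false (b ≟F punchIn b c) (punchInᵢ≢i b c ∘ sym)))

module _ {d : ℕ} where

  sameA-sym : ∀ {k m} (a : Addr d k) (b : Addr d m) → sameA a b ≡ sameA b a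
  sameA-sym root        root        = refl
  sameA-sym root        (top _)     = refl
  sameA-sym root        (child _ _) = refl
  sameA-sym (top _)     root        = refl
  sameA-sym (top s)     (top t)     = ⌊≟⌋-sym s t
  sameA-sym (top _)     (child _ _) = refl
  sameA-sym (child _ _) root        = refl
  sameA-sym (child _ _) (top _)     = refl
  sameA-sym (child u s) (child v t) = cong₂ _∧_ (sameA-sym u v) (⌊≟⌋-sym s t)

  sameA⇒≡-depth : ∀ {k m} (a : Addr d k) (b : Addr d m) → sameA a b ≡ true → k ≡ m
  sameA⇒≡-depth root        root        _ = refl
  sameA⇒≡-depth (top _)     (top _)     _ = refl
  sameA⇒≡-depth (child u _) (child v _) e with sameA u v in u~v
  ... | true  = cong suc (sameA⇒≡-depth u v u~v)
  ... | false with () ← e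
  sameA⇒≡-depth root        (top _)     ()
  sameA⇒≡-depth root        (child _ _) ()
  sameA⇒≡-depth (top _)     root        ()
  sameA⇒≡-depth (top _)     (child _ _) ()
  sameA⇒≡-depth (child _ _) root        ()
  sameA⇒≡-depth (child _ _) (top _)     ()

  isChildOf⇒≡-depth : ∀ {k m} (a : Addr d k) (b : Addr d m) → isChildOf a b ≡ true → k ≡ suc m
  isChildOf⇒≡-depth (top _)     b e = cong suc (sameA⇒≡-depth root b e)
  isChildOf⇒≡-depth (child u _) b e = cong suc (sameA⇒≡-depth u b e)

  isChildOf-parentA : ∀ {k m} (a : Addr d (suc k)) (b : Addr d m) → isChildOf a b ≡ sameA b (parentA a)
  isChildOf-parentA (top _)     b = sameA-sym root b
  isChildOf-parentA (child u _) b = sameA-sym u b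

  sum-𝟙-sameA-child : ∀ {k m} (u : Addr d m) (a : Addr d (suc k)) →
                      sum (λ c → 𝟙 (sameA u (child a c))) ≡ 𝟙 (isChildOf u a)
  sum-𝟙-sameA-child root        a           = sum-replicate-zero (d ∸ 1)
  sum-𝟙-sameA-child (top _)     (top _)     = sum-replicate-zero (d ∸ 1)
  sum-𝟙-sameA-child (top _)     (child _ _) = sum-replicate-zero (d ∸ 1)
  sum-𝟙-sameA-child (child u s) a with sameA u a
  ... | false = sum-replicate-zero (d ∸ 1)
  ... | true  = sum-𝟙-≟ s

module _ {d h : ℕ} where

  𝐱-p : ∀ {k} (le : suc k ≤ h) (a : Addr d (suc k)) (x : V d h) →
        𝐱 (p (suc k , le , a)) x ≡ 𝟙 (isChildOf a (addr x))
  𝐱-p le a x = cong 𝟙 (sym (isChildOf-parentA a (addr x)))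

  isChildOf-leaf : ∀ {k} (a : Addr d k) → k ≡ h → (x : V d h) → isChildOf (addr x) a ≡ false
  isChildOf-leaf a k≡h (kx , kx≤h , ax) with isChildOf ax a in ax◃a
  ... | false = refl
  ... | true  = ⊥-elim (ℕ.n≮n h (subst (_≤ h) kx≡1+h kx≤h))
    where
    kx≡1+h : kx ≡ suc h
    kx≡1+h = trans (isChildOf⇒≡-depth ax a ax◃a) (cong suc k≡h)

repunit : ℕ → ℕ → ℕ
repunit b zero    = 0
repunit b (suc m) = b ℕ.* repunit b m + 1

^-repunit : ∀ c m → suc c ^ m ≡ suc (repunit (suc c) m ℕ.* c)
^-repunit c zero    = refl
^-repunit c (suc m) = trans (cong (suc c ℕ.*_) (^-repunit c m)) (identity c (repunit (suc c) m))
  where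
  identity : ∀ c r → suc c ℕ.* suc (r ℕ.* c) ≡ suc ((suc c ℕ.* r + 1) ℕ.* c)
  identity = solveℕ-∀

θ≡repunit : ∀ e m → θ (suc (suc (suc e))) m ≡ repunit (suc (suc e)) m
θ≡repunit e m = trans (cong (λ t → (t ∸ 1) ℕ./ suc e) (^-repunit (suc e) m))
                      (m*n/n≡m (repunit (suc (suc e)) m) (suc e))

+repunit-suc : ∀ b m → + repunit b (suc m) ≡ + b * + repunit b m +ℤ + 1
+repunit-suc b m = trans (ℤ.pos-+ (b ℕ.* repunit b m) 1) (cong (_+ℤ + 1) (ℤ.pos-* b (repunit b m)))

step-identity : ∀ E B C I P K → B ≡ E * C +ℤ + 1 →
  (E * B +ℤ + 1) * I - B * P ≡ B * (((+ 1 +ℤ E) * I - P) - K) +ℤ (B * K - E * (C * I))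
step-identity E _ C I P K refl = solve (E ∷ C ∷ I ∷ P ∷ K ∷ [])

leaf-identity : ∀ E I P →
  (E * (E * + 0 +ℤ + 1) +ℤ + 1) * I - (E * + 0 +ℤ + 1) * P ≡ ((+ 1 +ℤ E) * I - P) - + 0
leaf-identity = solve-∀

module _ (b h : ℕ) where

  private
    R : ℕ → ℤ
    R m = + repunit b m

  repunit-relation : ∀ r {k} → suc k ≤ h → Addr (suc b) (suc k) → Vec (suc b) h
  repunit-relation r {k} le a x = R (2 + r) * 𝐱 (suc k , le , a) x - R (1 + r) * 𝐱 (p (suc k , le , a)) x

  repunit-relation-leaf : ∀ {k} (le : suc k ≤ h) (a : Addr (suc b) (suc k)) → suc k ≡ h →
                          repunit-relation 0 le a ≗ δ (suc b) h (suc k , le , a)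
  repunit-relation-leaf {k} le a k≡h x = begin
    R 2 * I - R 1 * P
      ≡⟨ cong₂ (λ s t → s * I - t * P) (trans (+repunit-suc b 1) (cong (λ t → + b * t +ℤ + 1) R1)) R1 ⟩
    (+ b * (+ b * + 0 +ℤ + 1) +ℤ + 1) * I - (+ b * + 0 +ℤ + 1) * P
      ≡⟨ leaf-identity (+ b) I P ⟩
    (+ suc b * I - P) - + 0
      ≡⟨ cong₂ (λ s t → (+ suc b * I - s) - 𝟙 t) (𝐱-p le a x) (sym (isChildOf-leaf a k≡h x)) ⟩
    δ (suc b) h (suc k , le , a) x ∎
    where
    open ≡-Reasoning
    I = 𝐱 (suc k , le , a) x
    P = 𝐱 (p (suc k , le , a)) x
    R1 : R 1 ≡ + b * + 0 +ℤ + 1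
    R1 = +repunit-suc b 0

  repunit-relation-suc : ∀ r {k} (le : suc k ≤ h) (le′ : suc (suc k) ≤ h) (a : Addr (suc b) (suc k)) →
    repunit-relation (suc r) le a
      ≗ λ x → R (2 + r) * δ (suc b) h (suc k , le , a) x +ℤ sum (λ c → repunit-relation r le′ (child a c) x)
  repunit-relation-suc r {k} le le′ a x = begin
    R (3 + r) * I - B * P
      ≡⟨ cong (λ t → t * I - B * P) (+repunit-suc b (2 + r)) ⟩
    (+ b * B +ℤ + 1) * I - B * P
      ≡⟨ step-identity (+ b) B C I P K (+repunit-suc b (1 + r)) ⟩
    B * (((+ 1 +ℤ + b) * I - P) - K) +ℤ (B * K - + b * (C * I))
      ≡⟨ cong₂ (λ s t → B * ((+ suc b * I - s) - K) +ℤ (B * t - + b * (C * I)))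
               (𝐱-p le a x) (sym (sum-𝟙-sameA-child (addr x) a)) ⟩
    B * δ (suc b) h (suc k , le , a) x +ℤ (B * sum X - + b * (C * I))
      ≡⟨ cong (B * δ (suc b) h (suc k , le , a) x +ℤ_) (sym (sum-affine B (C * I) X)) ⟩
    -- the child relations reduce to B * X c - C * I: 𝐱 compares addresses only, and p (child a c) has address a.
    B * δ (suc b) h (suc k , le , a) x +ℤ sum (λ c → repunit-relation r le′ (child a c) x) ∎
    where
    open ≡-Reasoning
    B = R (2 + r)
    C = R (1 + r)
    I = 𝐱 (suc k , le , a) x
    P = 𝐱 (p (suc k , le , a)) x
    K = 𝟙 (isChildOf (addr x) a)
    X : Fin b → ℤ
    X c = 𝟙 (sameA (addr x) (child a c))

  InSpan-repunit-relation : ∀ r {k} (le : suc k ≤ h) (a : Addr (suc b) (suc k)) → suc k + r ≡ h →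
                            InSpan (suc b) h (repunit-relation r le a)
  InSpan-repunit-relation zero {k} le a k+0≡h =
    InSpan-resp (InSpan-δ (suc k , le , a))
                (repunit-relation-leaf le a (trans (sym (ℕ.+-identityʳ (suc k))) k+0≡h))
  InSpan-repunit-relation (suc r) {k} le a k+r≡h =
    InSpan-resp (InSpan-+ (InSpan-* (repunit b (2 + r)) (InSpan-δ (suc k , le , a)))
                          (InSpan-sum _ (λ c → InSpan-repunit-relation r le′ (child a c) k′+r≡h)))
                (repunit-relation-suc r le le′ a)
    where
    k′+r≡h : suc (suc k) + r ≡ h
    k′+r≡h = trans (sym (ℕ.+-suc (suc k) r)) k+r≡h
    le′ : suc (suc k) ≤ h
    le′ = subst (suc (suc k) ≤_) k′+r≡h (ℕ.m≤m+n (suc (suc k)) r)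

lemma7p1 : (d h n : ℕ) → 3 ≤ d → 1 ≤ h → 1 ≤ n → n ≤ h → (j : V d h) → depth j ≡ n →
    IsZeroInG d h (λ x → (+ θ d (h + 2 ∸ n)) * 𝐱 j x - (+ θ d (h + 1 ∸ n)) * 𝐱 (p j) x)
lemma7p1 .(suc (suc (suc e))) h .(suc k) (s≤s (s≤s (s≤s {n = e} z≤n))) _ (s≤s z≤n) k<h (suc k , le , a) refl
  rewrite ℕ.+-∸-comm 2 k<h | ℕ.+-∸-comm 1 k<h
        | θ≡repunit e (h ∸ suc k + 2) | θ≡repunit e (h ∸ suc k + 1)
        | ℕ.+-comm (h ∸ suc k) 2 | ℕ.+-comm (h ∸ suc k) 1
  = InSpan-repunit-relation (suc (suc e)) h (h ∸ suc k) le a (ℕ.m+[n∸m]≡n k<h)
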